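{- Let $D$ be a finite simple digraph. Two $\gamma$-paths ${}_{u^*}P^{uv}_{w^*}$ and ${}_{x^*}P^{xy}_{z^*}$ in $\mathcal{W}(D)$ are edge disjoint if and only if $uv\neq xy$.
   Context: For a digraph $D$, $N_D(v)$ is the set of vertices joined to $v$ by an arc in either direction, $N_D[v]=N_D(v)\cup\{v\}$, $U\triangle V=(U\setminus V)\cup(V\setminus U)$. The digraph $\mathcal{W}(D)$: for each arc $vw$ of $D$ create new vertices $x^{vw}$ for every $x\in N_D(v)\triangle N_D(w)$ and $y^{vw}_x$ for every $x\in N_D(w)\setminus N_D[v]$, with arcs $v^{vw}\to x^{vw}$ for $x\in N_D(v)\setminus N_D(w)$ and arcs $v^{vw}\to y^{vw}_x$, $y^{vw}_x\to x^{vw}$ for $x\in N_D(w)\setminus N_D[v]$ (the $vw$-sector; sectors for distinct arcs are vertex-disjoint). Additionally add a vertex $x^*$ for each $x\in V(D)$, an arc $v^*\to v^{vw}$ for each arc $vw$ of $D$, and an arc $x^{vw}\to x^*$ for each vertex $x^{vw}$ with $x\neq v$. $\gamma$-paths: for an arc $vw$ of $D$ and $x\in N_D[v]\triangle N_D(w)$, the directed path ${}_{v^*}P^{vw}_{x^*}$ is $v^*\to v^{vw}\to x^{vw}\to x^*$ if $x\in N_D[v]\setminus N_D(w)$, and $v^*\to v^{vw}\to y^{vw}_x\to x^{vw}\to x^*$ if $x\in N_D(w)\setminus N_D[v]$. -}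

module Defs where

open import Data.Nat using (ℕ)
open import Data.Fin using (Fin; _≟_)
open import Data.Bool using (Bool; true; false; _∧_; _∨_; not; _xor_; T; if_then_else_)
open import Data.List using (List; []; _∷_)
open import Data.List.Membership.Propositional using (_∈_)
open import Data.Product using (_×_; _,_)
open import Data.Empty using (⊥)
open import Relation.Nullary using (¬_)
open import Relation.Nullary.Decidable using (⌊_⌋)
open import Relation.Binary.PropositionalEquality using (_≡_)

-- A finite simple digraph on vertex set Fin n: arcs given by a Boolean
-- relation (so no multiple arcs), with no loops.
record SimpleDigraph (n : ℕ) : Set where
  field
    arc   : Fin n → Fin n → Bool
    loopless : ∀ v → arc v v ≡ false
open SimpleDigraph public

module _ {n : ℕ} (D : SimpleDigraph n) where

  inN : Fin n → Fin n → Bool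
  inN v x = arc D v x ∨ arc D x v

  inNc : Fin n → Fin n → Bool
  inNc v x = ⌊ x ≟ v ⌋ ∨ inN v x

  -- Vertex labels of W(D):
  --   xv v w x  is  x^{vw},   yv v w x  is  y^{vw}_x,   st x  is  x^*.
  data Lbl : Set where
    xv : Fin n → Fin n → Fin n → Lbl
    yv : Fin n → Fin n → Fin n → Lbl
    st : Fin n → Lbl

  data WVertex : Lbl → Set where
    vx : ∀ {v w x} → T (arc D v w) → T (inN v x xor inN w x) → WVertex (xv v w x)
    vy : ∀ {v w x} → T (arc D v w) → T (inN w x ∧ not (inNc v x)) → WVertex (yv v w x)
    vs : ∀ x → WVertex (st x)

  data WArc : Lbl → Lbl → Set where
    a-vx : ∀ {v w x} → T (arc D v w) → T (inN v x ∧ not (inN w x)) →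
           WArc (xv v w v) (xv v w x)
    a-vy : ∀ {v w x} → T (arc D v w) → T (inN w x ∧ not (inNc v x)) →
           WArc (xv v w v) (yv v w x)
    a-yx : ∀ {v w x} → T (arc D v w) → T (inN w x ∧ not (inNc v x)) →
           WArc (yv v w x) (xv v w x)
    a-sv : ∀ {v w} → T (arc D v w) → WArc (st v) (xv v w v)
    a-xs : ∀ {v w x} → T (arc D v w) → T (inN v x xor inN w x) → ¬ (x ≡ v) →
           WArc (xv v w x) (st x)

  γcond : Fin n → Fin n → Fin n → Bool
  γcond v w x = inNc v x xor inN w x

  γpath : Fin n → Fin n → Fin n → List Lbl
  γpath v w x =
    if inNc v x ∧ not (inN w x)
    then st v ∷ xv v w v ∷ xv v w x ∷ st x ∷ []
    else st v ∷ xv v w v ∷ yv v w x ∷ xv v w x ∷ st x ∷ []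

  arcsOf : List Lbl → List (Lbl × Lbl)
  arcsOf (a ∷ b ∷ rest) = (a , b) ∷ arcsOf (b ∷ rest)
  arcsOf _ = []

  EdgeDisjoint : List Lbl → List Lbl → Set
  EdgeDisjoint P Q = ∀ e → e ∈ arcsOf P → e ∈ arcsOf Q → ⊥

-- Every arc of W(D) touches exactly one sector, and a γ-path for the arc uv uses
-- only arcs touching the uv-sector, so γ-paths of different arcs of D cannot share
-- an arc. Conversely both γ-paths for uv begin with u* → u^{uv}. Neither direction
-- needs the hypotheses that uv is an arc or that the γ-conditions hold.
module Submission where

open import Defs
open import Data.Nat using (ℕ)
open import Data.Fin using (Fin)
open import Data.Bool using (T; true; false; _∧_; not)
open import Data.Maybe using (Maybe; just; nothing)
open import Data.Maybe.Properties using (just-injective)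
open import Data.Product using (_,_; _×_)
open import Data.List.Relation.Unary.All using (All; []; _∷_; lookup)
open import Data.List.Relation.Unary.Any using (here)
open import Data.List.Membership.Propositional using (_∈_)
open import Relation.Nullary using (¬_)
open import Relation.Binary.PropositionalEquality using (_≡_; refl; sym; trans)
open import Function.Bundles using (_⇔_; mk⇔)

module _ {n : ℕ} (D : SimpleDigraph n) where

  -- W(D) has no arc x* → y*, the only kind of pair not touching a sector.
  arcSector : Lbl D × Lbl D → Maybe (Fin n × Fin n)
  arcSector (xv v w _ , _)      = just (v , w)
  arcSector (yv v w _ , _)      = just (v , w)
  arcSector (st _ , xv v w _)   = just (v , w)
  arcSector (st _ , yv v w _)   = just (v , w)
  arcSector (st _ , st _)       = nothing

  γpath-arcs-in-sector : ∀ u v w →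
    All (λ e → arcSector e ≡ just (u , v)) (arcsOf D (γpath D u v w))
  γpath-arcs-in-sector u v w with inNc D u w ∧ not (inN D v w)
  ... | true  = refl ∷ refl ∷ refl ∷ []
  ... | false = refl ∷ refl ∷ refl ∷ refl ∷ []

  γpath-starts-with-entry : ∀ u v w → (st u , xv u v u) ∈ arcsOf D (γpath D u v w)
  γpath-starts-with-entry u v w with inNc D u w ∧ not (inN D v w)
  ... | true  = here refl
  ... | false = here refl

  γpaths-share-arc⇒same-arc : ∀ u v w x y z e →
    e ∈ arcsOf D (γpath D u v w) → e ∈ arcsOf D (γpath D x y z) →
    (u , v) ≡ (x , y)
  γpaths-share-arc⇒same-arc u v w x y z e e∈P e∈Q = just-injective
    (trans (sym (lookup (γpath-arcs-in-sector u v w) e∈P))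
           (lookup (γpath-arcs-in-sector x y z) e∈Q))

mainTheorem2 : ∀ {n : ℕ} (D : SimpleDigraph n) (u v w x y z : Fin n) →
    T (arc D u v) → T (γcond D u v w) →
    T (arc D x y) → T (γcond D x y z) →
    EdgeDisjoint D (γpath D u v w) (γpath D x y z) ⇔ (¬ ((u , v) ≡ (x , y)))
mainTheorem2 D u v w x y z _ _ _ _ = mk⇔ disjoint⇒distinct distinct⇒disjoint
  where
  disjoint⇒distinct : EdgeDisjoint D (γpath D u v w) (γpath D x y z) →
                      ¬ ((u , v) ≡ (x , y))
  disjoint⇒distinct disjoint refl =
    disjoint _ (γpath-starts-with-entry D u v w) (γpath-starts-with-entry D u v z)

  distinct⇒disjoint : ¬ ((u , v) ≡ (x , y)) →
                      EdgeDisjoint D (γpath D u v w) (γpath D x y z)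
  distinct⇒disjoint uv≢xy e e∈P e∈Q =
    uv≢xy (γpaths-share-arc⇒same-arc D u v w x y z e e∈P e∈Q)
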